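{- Let $k\in\mathbb{N}$. If a finite simple graph $G$ contains $k$ pairwise vertex-disjoint cycles, then $\Delta(G)\ge 2^k$.
   Context: For a finite simple graph $G$, the elements of $G$ are its vertices and edges. Two elements $\alpha,\beta\in V(G)\cup E(G)$ are incident if $\alpha=\beta$, or one is an edge and the other is an endpoint of that edge. $M(G)$ is the $0/1$ matrix with rows and columns indexed by $V(G)\cup E(G)$ whose $(\alpha,\beta)$ entry is $1$ iff $\alpha$ and $\beta$ are incident; equivalently $M(G)=\begin{bmatrix} I & B\\ B^\intercal & I\end{bmatrix}$ where $B$ is the vertex-edge incidence matrix of $G$. $\Delta(G)$ denotes the maximum of $|\det M'|$ over all square submatrices $M'$ of $M(G)$. -}

module Defs where

open import Data.Nat using (ℕ; zero; suc; _≤_; _^_; _≥_)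
open import Data.Fin using (Fin; zero; suc; inject₁; fromℕ; punchIn)
open import Data.Integer using (ℤ; +_; -_; _*_; _+_; ∣_∣)
open import Data.Product using (Σ; _×_; _,_; proj₁; proj₂; ∃)
open import Data.Sum using (_⊎_; inj₁; inj₂)
open import Data.Bool using (Bool; true; false; if_then_else_; _∨_)
open import Relation.Nullary using (¬_)
open import Relation.Nullary.Decidable using (⌊_⌋)
open import Relation.Binary.PropositionalEquality using (_≡_; _≢_)
open import Function.Definitions using (Injective)
import Data.Fin as F

record Graph : Set where
  field
    n : ℕ
    m : ℕ
    ends : Fin m → Fin n × Fin n
    loopless : ∀ e → proj₁ (ends e) ≢ proj₂ (ends e)
    simple : ∀ e f →
      ((proj₁ (ends e) ≡ proj₁ (ends f) × proj₂ (ends e) ≡ proj₂ (ends f))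
       ⊎ (proj₁ (ends e) ≡ proj₂ (ends f) × proj₂ (ends e) ≡ proj₁ (ends f)))
      → e ≡ f

open Graph public

Elt : Graph → Set
Elt G = Fin (n G) ⊎ Fin (m G)

isEnd : (G : Graph) → Fin (n G) → Fin (m G) → Bool
isEnd G v e = ⌊ v F.≟ proj₁ (ends G e) ⌋ ∨ ⌊ v F.≟ proj₂ (ends G e) ⌋

b2z : Bool → ℤ
b2z true = + 1
b2z false = + 0

M : (G : Graph) → Elt G → Elt G → ℤ
M G (inj₁ v) (inj₁ w) = b2z ⌊ v F.≟ w ⌋
M G (inj₁ v) (inj₂ e) = b2z (isEnd G v e)
M G (inj₂ e) (inj₁ v) = b2z (isEnd G v e)
M G (inj₂ e) (inj₂ f) = b2z ⌊ e F.≟ f ⌋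

Σℤ : (k : ℕ) → (Fin k → ℤ) → ℤ
Σℤ zero f = + 0
Σℤ (suc k) f = f zero + Σℤ k (λ i → f (suc i))

sign : ℕ → ℤ
sign zero = + 1
sign (suc j) = - sign j

det : (k : ℕ) → (Fin k → Fin k → ℤ) → ℤ
det zero A = + 1
det (suc k) A =
  Σℤ (suc k) (λ j → sign (F.toℕ j) * (A zero j * det k (λ r c → A (suc r) (punchIn j c))))

-- Δ(G) ≥ d : some square submatrix of M(G) (rows and columns chosen by
-- injective maps, i.e. distinct elements, possibly reordered -- which only
-- affects the sign of the determinant) has |det| ≥ d.
Δ≥ : Graph → ℕ → Set
Δ≥ G d = Σ ℕ λ s → Σ (Fin s → Elt G) λ rows → Σ (Fin s → Elt G) λ cols →
  Injective _≡_ _≡_ rows × Injective _≡_ _≡_ cols ×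
  ∣ det s (λ i j → M G (rows i) (cols j)) ∣ ≥ d

Adj : (G : Graph) → Fin (n G) → Fin (n G) → Set
Adj G u v = ∃ λ e → (proj₁ (ends G e) ≡ u × proj₂ (ends G e) ≡ v)
                  ⊎ (proj₁ (ends G e) ≡ v × proj₂ (ends G e) ≡ u)

-- A cycle: distinct vertices c 0, …, c L (L ≥ 2, so length ≥ 3) with
-- c i ~ c (i+1) and c L ~ c 0.
record Cycle (G : Graph) : Set where
  field
    L : ℕ
    len≥3 : 2 ≤ L
    vert : Fin (suc L) → Fin (n G)
    distinct : Injective _≡_ _≡_ vert
    step : ∀ (i : Fin L) → Adj G (vert (inject₁ i)) (vert (suc i))
    close : Adj G (vert (fromℕ L)) (vert zero)

open Cycle public

DisjointCycles : (G : Graph) → (k : ℕ) → Set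
DisjointCycles G k = Σ (Fin k → Cycle G) λ C →
  ∀ i j → i ≢ j → ∀ a b → vert (C i) a ≢ vert (C j) b

{-# OPTIONS --safe #-}
-- A cycle with vertices v₀, …, v_L and edges eᵢ = vᵢvᵢ₊₁ (indices mod L + 1) yields a square
-- submatrix of M(G) with determinant 2 that uses only elements of the cycle.  For an odd cycle
-- take rows v₀, …, v_L and columns e₀, …, e_L: this is I + P for a cyclic permutation matrix P of
-- odd order, whose determinant is 1 + 1.  For an even cycle replace the column e₀ by the columns
-- v₀, v₁ and add the row e₀; the result has the same shape, now of odd size L + 2.  No element of
-- one cycle is incident with an element of a vertex-disjoint one, so the submatrices of k disjoint
-- cycles assemble into a block-triangular matrix of determinant 2^k.
module Submission where

open import Defs
open import Data.Nat using (ℕ; _^_)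

open import Data.Bool using (Bool; true; false; _∨_; _∧_)
open import Data.Bool.Properties using (∨-identityʳ; ∨-zeroʳ; ∨-comm; ∧-identityʳ; ∧-zeroʳ; ¬-not; T-≡)
open import Data.Empty using (⊥-elim)
open import Data.Fin using (Fin; zero; suc; toℕ; fromℕ; inject₁; punchIn; splitAt; join; _↑ˡ_; _↑ʳ_; _≟_)
open import Data.Fin.Properties using (toℕ-fromℕ; toℕ-inject₁; toℕ<n; toℕ-injective; toℕ-↑ˡ; join-splitAt; suc-injective)
open import Data.Fin.Relation.Unary.Top using (View; view; ‵fromℕ; ‵inject₁)
open import Data.Integer using (ℤ; +_; -_; _+_; _*_; ∣_∣)
import Data.Integer.Properties as ℤ
open import Data.Nat using (suc; zero; _≤_; _<_; _≡ᵇ_; z≤n; s≤s; s≤s⁻¹)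
import Data.Nat as ℕ
import Data.Nat.Properties as ℕ
open import Data.Product using (∃; _×_; _,_; proj₁; proj₂)
open import Data.Sum using (_⊎_; inj₁; inj₂; [_,_]′)
open import Data.Sum.Properties using (inj₁-injective; inj₂-injective)
open import Data.Vec.Functional using (Vector; _++_)
open import Data.Vec.Functional.Properties using (lookup-++ˡ; lookup-++ʳ)
open import Function using (_∘_; mk⇔; Equivalence)
open import Function.Definitions using (Injective)
open import Level using (0ℓ)
open import Relation.Binary.PropositionalEquality
open import Relation.Nullary using (Dec; ¬_)
open import Relation.Nullary.Decidable using (⌊_⌋; dec-no; dec-true; dec-false; isYes≗does; does-⇔)
open import Relation.Unary using (Pred; _⊆_; _∪_; _⊥_; ⋃)

open ≡-Reasoning

-- Determinants

Σℤ-cong : ∀ k {f g : Fin k → ℤ} → (∀ i → f i ≡ g i) → Σℤ k f ≡ Σℤ k g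
Σℤ-cong zero    f≗g = refl
Σℤ-cong (suc k) f≗g = cong₂ _+_ (f≗g zero) (Σℤ-cong k (f≗g ∘ suc))

Σℤ-zero : ∀ k {f : Fin k → ℤ} → (∀ i → f i ≡ + 0) → Σℤ k f ≡ + 0
Σℤ-zero zero    f≗0 = refl
Σℤ-zero (suc k) f≗0 = cong₂ _+_ (f≗0 zero) (Σℤ-zero k (f≗0 ∘ suc))

Σℤ-*ʳ : ∀ k (f : Fin k → ℤ) x → Σℤ k (λ i → f i * x) ≡ Σℤ k f * x
Σℤ-*ʳ zero    f x = refl
Σℤ-*ʳ (suc k) f x = begin
  f zero * x + Σℤ k (λ i → f (suc i) * x)  ≡⟨ cong (_+_ (f zero * x)) (Σℤ-*ʳ k (f ∘ suc) x) ⟩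
  f zero * x + Σℤ k (f ∘ suc) * x          ≡⟨ ℤ.*-distribʳ-+ x (f zero) _ ⟨
  Σℤ (suc k) f * x                         ∎

Σℤ-++ : ∀ a b (f : Fin (a ℕ.+ b) → ℤ) →
        Σℤ (a ℕ.+ b) f ≡ Σℤ a (f ∘ (_↑ˡ b)) + Σℤ b (f ∘ (a ↑ʳ_))
Σℤ-++ zero    b f = sym (ℤ.+-identityˡ _)
Σℤ-++ (suc a) b f = trans (cong (_+_ (f zero)) (Σℤ-++ a b (f ∘ suc))) (sym (ℤ.+-assoc (f zero) _ _))

Σℤ-last : ∀ k (f : Fin (suc k) → ℤ) → Σℤ (suc k) f ≡ Σℤ k (f ∘ inject₁) + f (fromℕ k)
Σℤ-last zero    f = ℤ.+-comm (f zero) (+ 0)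
Σℤ-last (suc k) f = trans (cong (_+_ (f zero)) (Σℤ-last k (f ∘ suc))) (sym (ℤ.+-assoc (f zero) _ _))

Matrix : ℕ → Set
Matrix k = Fin k → Fin k → ℤ

minor : ∀ {k} → Matrix (suc k) → Fin (suc k) → Matrix k
minor A j r c = A (suc r) (punchIn j c)

laplaceTerm : ∀ {k} → Matrix (suc k) → Fin (suc k) → ℤ
laplaceTerm {k} A j = sign (toℕ j) * (A zero j * det k (minor A j))

laplaceTerm-zeroEntry : ∀ {k} (A : Matrix (suc k)) j → A zero j ≡ + 0 → laplaceTerm A j ≡ + 0
laplaceTerm-zeroEntry A j A₀ⱼ≡0 rewrite A₀ⱼ≡0 = ℤ.*-zeroʳ (sign (toℕ j))

laplaceTerm-singularMinor : ∀ {k} (A : Matrix (suc k)) j → det k (minor A j) ≡ + 0 → laplaceTerm A j ≡ + 0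
laplaceTerm-singularMinor A j det≡0 rewrite det≡0 | ℤ.*-zeroʳ (A zero j) = ℤ.*-zeroʳ (sign (toℕ j))

det-cong : ∀ k {A B : Matrix k} → (∀ r c → A r c ≡ B r c) → det k A ≡ det k B
det-cong zero    A≗B = refl
det-cong (suc k) A≗B = Σℤ-cong (suc k) λ j →
  cong₂ (λ x y → sign (toℕ j) * (x * y)) (A≗B zero j) (det-cong k λ r c → A≗B (suc r) (punchIn j c))

det-onlyFirstTerm : ∀ {k} (A : Matrix (suc k)) → (∀ j → laplaceTerm A (suc j) ≡ + 0) →
                    det (suc k) A ≡ A zero zero * det k (minor A zero)
det-onlyFirstTerm {k} A rest≡0 = begin
  laplaceTerm A zero + Σℤ k (laplaceTerm A ∘ suc)  ≡⟨ cong (_+_ (laplaceTerm A zero)) (Σℤ-zero k rest≡0) ⟩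
  laplaceTerm A zero + + 0                         ≡⟨ ℤ.+-identityʳ _ ⟩
  + 1 * (A zero zero * det k (minor A zero))       ≡⟨ ℤ.*-identityˡ _ ⟩
  A zero zero * det k (minor A zero)               ∎

det-zeroFirstColumn : ∀ {k} (A : Matrix (suc k)) → (∀ r → A r zero ≡ + 0) → det (suc k) A ≡ + 0
det-minor-zeroFirstColumn : ∀ {k} (A : Matrix (suc k)) → (∀ r → A (suc r) zero ≡ + 0) →
                            ∀ j → det k (minor A (suc j)) ≡ + 0

det-zeroFirstColumn {k} A col≡0 = Σℤ-zero (suc k) {laplaceTerm A} λ where
  zero    → laplaceTerm-zeroEntry A zero (col≡0 zero)
  (suc j) → laplaceTerm-singularMinor A (suc j) (det-minor-zeroFirstColumn A (col≡0 ∘ suc) j)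

det-minor-zeroFirstColumn {suc k} A col≡0 j = det-zeroFirstColumn (minor A (suc j)) col≡0

det-unitLowerTriangular : ∀ k (A : Matrix k) → (∀ r c → toℕ r < toℕ c → A r c ≡ + 0) →
                          (∀ i → A i i ≡ + 1) → det k A ≡ + 1
det-unitLowerTriangular zero    A lower diag = refl
det-unitLowerTriangular (suc k) A lower diag = begin
  det (suc k) A                       ≡⟨ det-onlyFirstTerm A firstRow≡0 ⟩
  A zero zero * det k (minor A zero)  ≡⟨ cong₂ _*_ (diag zero) minor≡1 ⟩
  + 1                                 ∎
  where
  firstRow≡0 : ∀ j → laplaceTerm A (suc j) ≡ + 0
  firstRow≡0 j = laplaceTerm-zeroEntry A (suc j) (lower zero (suc j) (s≤s z≤n))
  minor≡1 : det k (minor A zero) ≡ + 1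
  minor≡1 = det-unitLowerTriangular k (minor A zero) (λ r c → lower (suc r) (suc c) ∘ s≤s) (diag ∘ suc)

det-unitUpperTriangular : ∀ k (A : Matrix k) → (∀ r c → toℕ c < toℕ r → A r c ≡ + 0) →
                          (∀ i → A i i ≡ + 1) → det k A ≡ + 1
det-unitUpperTriangular zero    A upper diag = refl
det-unitUpperTriangular (suc k) A upper diag = begin
  det (suc k) A                       ≡⟨ det-onlyFirstTerm A firstRow≡0 ⟩
  A zero zero * det k (minor A zero)  ≡⟨ cong₂ _*_ (diag zero) minor≡1 ⟩
  + 1                                 ∎
  where
  firstRow≡0 : ∀ j → laplaceTerm A (suc j) ≡ + 0
  firstRow≡0 j = laplaceTerm-singularMinor A (suc j)
    (det-minor-zeroFirstColumn A (λ r → upper (suc r) zero (s≤s z≤n)) j)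
  minor≡1 : det k (minor A zero) ≡ + 1
  minor≡1 = det-unitUpperTriangular k (minor A zero) (λ r c → upper (suc r) (suc c) ∘ s≤s) (diag ∘ suc)

punchIn-↑ˡ : ∀ {a} b (j : Fin (suc a)) (c : Fin a) → punchIn (j ↑ˡ b) (c ↑ˡ b) ≡ punchIn j c ↑ˡ b
punchIn-↑ˡ b zero    c       = refl
punchIn-↑ˡ b (suc j) zero    = refl
punchIn-↑ˡ b (suc j) (suc c) = cong suc (punchIn-↑ˡ b j c)

punchIn-↑ʳ : ∀ a {b} (j : Fin (suc a)) (c : Fin b) → punchIn (j ↑ˡ b) (a ↑ʳ c) ≡ suc a ↑ʳ c
punchIn-↑ʳ a       zero    c = refl
punchIn-↑ʳ (suc a) (suc j) c = cong suc (punchIn-↑ʳ a j c)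

det-blockLowerTriangular :
  ∀ a b (A : Matrix (a ℕ.+ b)) → (∀ r c → A (r ↑ˡ b) (a ↑ʳ c) ≡ + 0) →
  det (a ℕ.+ b) A ≡ det a (λ r c → A (r ↑ˡ b) (c ↑ˡ b)) * det b (λ r c → A (a ↑ʳ r) (a ↑ʳ c))
det-blockLowerTriangular zero    b A _      = sym (ℤ.*-identityˡ _)
det-blockLowerTriangular (suc a) b A upperRight≡0 = begin
  Σℤ (suc a ℕ.+ b) (laplaceTerm A)
    ≡⟨ Σℤ-++ (suc a) b (laplaceTerm A) ⟩
  Σℤ (suc a) (laplaceTerm A ∘ (_↑ˡ b)) + Σℤ b (laplaceTerm A ∘ (suc a ↑ʳ_))
    ≡⟨ cong₂ _+_ (Σℤ-cong (suc a) leftTerm)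
                 (Σℤ-zero b λ c → laplaceTerm-zeroEntry A _ (upperRight≡0 zero c)) ⟩
  Σℤ (suc a) (λ j → laplaceTerm A₁ j * det₂) + + 0
    ≡⟨ ℤ.+-identityʳ _ ⟩
  Σℤ (suc a) (λ j → laplaceTerm A₁ j * det₂)
    ≡⟨ Σℤ-*ʳ (suc a) (laplaceTerm A₁) det₂ ⟩
  det (suc a) A₁ * det₂ ∎
  where
  A₁ : Matrix (suc a)
  A₁ r c = A (r ↑ˡ b) (c ↑ˡ b)
  det₂ : ℤ
  det₂ = det b (λ r c → A (suc a ↑ʳ r) (suc a ↑ʳ c))

  minor-↑ˡ : ∀ j → det (a ℕ.+ b) (minor A (j ↑ˡ b)) ≡ det a (minor A₁ j) * det₂
  minor-↑ˡ j = begin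
    det (a ℕ.+ b) (minor A (j ↑ˡ b))
      ≡⟨ det-blockLowerTriangular a b (minor A (j ↑ˡ b))
           (λ r c → trans (cong (A (suc (r ↑ˡ b))) (punchIn-↑ʳ a j c)) (upperRight≡0 (suc r) c)) ⟩
    det a (λ r c → A (suc (r ↑ˡ b)) (punchIn (j ↑ˡ b) (c ↑ˡ b)))
      * det b (λ r c → A (suc (a ↑ʳ r)) (punchIn (j ↑ˡ b) (a ↑ʳ c)))
      ≡⟨ cong₂ _*_ (det-cong a λ r c → cong (A (suc (r ↑ˡ b))) (punchIn-↑ˡ b j c))
                   (det-cong b λ r c → cong (A (suc (a ↑ʳ r))) (punchIn-↑ʳ a j c)) ⟩
    det a (minor A₁ j) * det₂ ∎

  leftTerm : ∀ j → laplaceTerm A (j ↑ˡ b) ≡ laplaceTerm A₁ j * det₂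
  leftTerm j = begin
    sign (toℕ (j ↑ˡ b)) * (A₁ zero j * det (a ℕ.+ b) (minor A (j ↑ˡ b)))
      ≡⟨ cong₂ (λ n d → sign n * (A₁ zero j * d)) (toℕ-↑ˡ j b) (minor-↑ˡ j) ⟩
    sign (toℕ j) * (A₁ zero j * (det a (minor A₁ j) * det₂))
      ≡⟨ cong (sign (toℕ j) *_) (sym (ℤ.*-assoc (A₁ zero j) _ det₂)) ⟩
    sign (toℕ j) * (A₁ zero j * det a (minor A₁ j) * det₂)
      ≡⟨ sym (ℤ.*-assoc (sign (toℕ j)) _ det₂) ⟩
    laplaceTerm A₁ j * det₂ ∎

-- The incidence matrix of a cycle

≡ᵇ-refl : ∀ n → (n ≡ᵇ n) ≡ true
≡ᵇ-refl n = dec-true (n ℕ.≟ n) refl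

≢⇒≡ᵇ≡false : ∀ {m n} → m ≢ n → (m ≡ᵇ n) ≡ false
≢⇒≡ᵇ≡false {m} {n} = dec-false (m ℕ.≟ n)

≡ᵇ≡true⇒≡ : ∀ {m n} → (m ≡ᵇ n) ≡ true → m ≡ n
≡ᵇ≡true⇒≡ {m} {n} = ℕ.≡ᵇ⇒≡ m n ∘ Equivalence.from T-≡

-- Vertex a and edge b of the cycle 0, 1, …, m - 1 are incident, edge b joining b and b + 1 (mod m).
CycleIncident : ℕ → ℕ → ℕ → Set
CycleIncident m a b = a ≡ b ⊎ a ≡ suc b ⊎ (a ≡ 0 × suc b ≡ m)

cycleIncidence : ℕ → ℕ → ℕ → Bool
cycleIncidence m a b = (a ≡ᵇ b) ∨ ((a ≡ᵇ suc b) ∨ ((a ≡ᵇ 0) ∧ (suc b ≡ᵇ m)))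

cycleIncidence-complete : ∀ m a b → CycleIncident m a b → cycleIncidence m a b ≡ true
cycleIncidence-complete m a b (inj₁ refl) rewrite ≡ᵇ-refl a = refl
cycleIncidence-complete m a b (inj₂ (inj₁ refl)) rewrite ≡ᵇ-refl b = ∨-zeroʳ _
cycleIncidence-complete m a b (inj₂ (inj₂ (refl , refl))) rewrite ≡ᵇ-refl b = ∨-zeroʳ _

cycleIncidence-sound : ∀ m a b → cycleIncidence m a b ≡ true → CycleIncident m a b
cycleIncidence-sound m a b incident
  with a ≡ᵇ b in a≡b | a ≡ᵇ suc b in a≡1+b | a ≡ᵇ 0 in a≡0
... | true  | _     | _    = inj₁ (≡ᵇ≡true⇒≡ a≡b)
... | false | true  | _    = inj₂ (inj₁ (≡ᵇ≡true⇒≡ a≡1+b))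
... | false | false | true = inj₂ (inj₂ (≡ᵇ≡true⇒≡ a≡0 , ≡ᵇ≡true⇒≡ incident))

cycleIncidence-false : ∀ m a b → ¬ CycleIncident m a b → cycleIncidence m a b ≡ false
cycleIncidence-false m a b ¬incident = ¬-not (¬incident ∘ cycleIncidence-sound m a b)

cycleIncidence-antisym : ∀ ℓ {a b} → CycleIncident (3 ℕ.+ ℓ) a b → CycleIncident (3 ℕ.+ ℓ) b a → a ≡ b
cycleIncidence-antisym ℓ (inj₁ a≡b) _           = a≡b
cycleIncidence-antisym ℓ _          (inj₁ b≡a) = sym b≡a
cycleIncidence-antisym ℓ {b = b} (inj₂ (inj₁ refl)) (inj₂ (inj₁ b≡2+b)) =
  ⊥-elim (ℕ.<⇒≢ (ℕ.m<n⇒m<1+n (ℕ.n<1+n b)) b≡2+b)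
cycleIncidence-antisym ℓ (inj₂ (inj₁ refl)) (inj₂ (inj₂ (refl , ())))
cycleIncidence-antisym ℓ (inj₂ (inj₂ (refl , ()))) (inj₂ (inj₁ refl))
cycleIncidence-antisym ℓ (inj₂ (inj₂ (refl , _))) (inj₂ (inj₂ (refl , _))) = refl

cycleIncidence-offBand : ∀ m {a b} → b < a ⊎ suc a < b → cycleIncidence m (suc a) b ≡ false
cycleIncidence-offBand m {a} {b} off = cycleIncidence-false m (suc a) b λ where
  (inj₁ refl) → [ ℕ.<-asym (ℕ.n<1+n a) , ℕ.<-irrefl refl ]′ off
  (inj₂ (inj₁ refl)) → [ ℕ.<-irrefl refl , ℕ.<-irrefl refl ∘ ℕ.<-trans (ℕ.n<1+n a) ]′ off
  (inj₂ (inj₂ (() , _)))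

cycleMatrix : (m : ℕ) → Matrix m
cycleMatrix m i j = b2z (cycleIncidence m (toℕ i) (toℕ j))

punchIn-fromℕ : ∀ n (c : Fin n) → punchIn (fromℕ n) c ≡ inject₁ c
punchIn-fromℕ (suc n) zero    = refl
punchIn-fromℕ (suc n) (suc c) = cong suc (punchIn-fromℕ n c)

-- Row 0 has only the diagonal entry and the corner entry, whose minors are unit lower and unit
-- upper triangular respectively.
det-cycleMatrix : ∀ k → det (suc (suc k)) (cycleMatrix (suc (suc k))) ≡ + 1 + sign (suc k)
det-cycleMatrix k = begin
  laplaceTerm A zero + Σℤ (suc k) (laplaceTerm A ∘ suc)
    ≡⟨ cong (_+_ (laplaceTerm A zero)) (Σℤ-last k (laplaceTerm A ∘ suc)) ⟩
  laplaceTerm A zero + (Σℤ k (laplaceTerm A ∘ suc ∘ inject₁) + laplaceTerm A (suc (fromℕ k)))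
    ≡⟨ cong₂ (λ x y → x + (y + laplaceTerm A (suc (fromℕ k))))
             firstTerm (Σℤ-zero k {laplaceTerm A ∘ suc ∘ inject₁} middleTerm) ⟩
  + 1 + (+ 0 + laplaceTerm A (suc (fromℕ k)))
    ≡⟨ cong (_+_ (+ 1)) (ℤ.+-identityˡ (laplaceTerm A (suc (fromℕ k)))) ⟩
  + 1 + laplaceTerm A (suc (fromℕ k))
    ≡⟨ cong (_+_ (+ 1)) lastTerm ⟩
  + 1 + sign (suc k) ∎
  where
  A : Matrix (suc (suc k))
  A = cycleMatrix (suc (suc k))

  firstTerm : laplaceTerm A zero ≡ + 1
  firstTerm = cong (λ d → + 1 * (+ 1 * d)) (det-unitLowerTriangular (suc k) (minor A zero) lower diag)
    where
    lower : ∀ r c → toℕ r < toℕ c → minor A zero r c ≡ + 0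
    lower r c r<c = cong b2z (cycleIncidence-offBand (suc (suc k)) (inj₂ (s≤s r<c)))
    diag : ∀ r → minor A zero r r ≡ + 1
    diag r = cong b2z (cycleIncidence-complete (suc (suc k)) (suc (toℕ r)) _ (inj₁ refl))

  middleTerm : ∀ i → laplaceTerm A (suc (inject₁ i)) ≡ + 0
  middleTerm i = laplaceTerm-zeroEntry A (suc (inject₁ i)) (cong b2z (cycleIncidence-false _ _ _ notIncident))
    where
    notIncident : ¬ CycleIncident (suc (suc k)) 0 (suc (toℕ (inject₁ i)))
    notIncident (inj₂ (inj₂ (_ , i≡k))) =
      ℕ.<⇒≢ (subst (_< k) (sym (toℕ-inject₁ i)) (toℕ<n i)) (ℕ.suc-injective (ℕ.suc-injective i≡k))

  lastTerm : laplaceTerm A (suc (fromℕ k)) ≡ sign (suc k)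
  lastTerm = begin
    sign (suc (toℕ (fromℕ k))) * (A zero (suc (fromℕ k)) * det (suc k) (minor A (suc (fromℕ k))))
      ≡⟨ cong₂ (λ n x → sign (suc n) * x) (toℕ-fromℕ k)
               (cong₂ _*_ corner (det-unitUpperTriangular (suc k) _ upper diag)) ⟩
    sign (suc k) * + 1
      ≡⟨ ℤ.*-identityʳ _ ⟩
    sign (suc k) ∎
    where
    corner : A zero (suc (fromℕ k)) ≡ + 1
    corner = cong b2z (cycleIncidence-complete (suc (suc k)) 0 (suc (toℕ (fromℕ k)))
      (inj₂ (inj₂ (refl , cong suc (cong suc (toℕ-fromℕ k))))))
    upper : ∀ r c → toℕ c < toℕ r → minor A (suc (fromℕ k)) r c ≡ + 0
    upper r c c<r rewrite punchIn-fromℕ (suc k) c | toℕ-inject₁ c =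
      cong b2z (cycleIncidence-offBand (suc (suc k)) (inj₁ c<r))
    diag : ∀ r → minor A (suc (fromℕ k)) r r ≡ + 1
    diag r rewrite punchIn-fromℕ (suc k) r | toℕ-inject₁ r =
      cong b2z (cycleIncidence-complete (suc (suc k)) (suc (toℕ r)) (toℕ r) (inj₂ (inj₁ refl)))

sign-parity : ∀ n → sign n ≡ + 1 ⊎ sign (suc n) ≡ + 1
sign-parity zero = inj₁ refl
sign-parity (suc n) with sign-parity n
... | inj₁ sign≡1 = inj₂ (cong (-_ ∘ -_) sign≡1)
... | inj₂ sign≡1 = inj₁ sign≡1

cyclicSuc : ∀ {n} {i : Fin (suc n)} → View i → Fin (suc n)
cyclicSuc ‵fromℕ       = zero
cyclicSuc (‵inject₁ j) = suc j

cycleIncidence-cyclicSuc : ∀ {n a} {j : Fin (suc n)} (w : View j) → a ≤ n →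
  (a ≡ᵇ toℕ j) ∨ (a ≡ᵇ toℕ (cyclicSuc w)) ≡ cycleIncidence (suc n) a (toℕ j)
cycleIncidence-cyclicSuc {n} {a} ‵fromℕ a≤n
  rewrite toℕ-fromℕ n | ≢⇒≡ᵇ≡false (ℕ.<⇒≢ (s≤s a≤n)) | ≡ᵇ-refl n | ∧-identityʳ (a ≡ᵇ 0) = refl
cycleIncidence-cyclicSuc {n} {a} (‵inject₁ j) a≤n
  rewrite toℕ-inject₁ j | ≢⇒≡ᵇ≡false (ℕ.<⇒≢ (toℕ<n j))
        | ∧-zeroʳ (a ≡ᵇ 0) | ∨-identityʳ (a ≡ᵇ suc (toℕ j)) = refl

-- Incidence in induced subgraphs

⌊⌋-yes : ∀ {A : Set} (a? : Dec A) → A → ⌊ a? ⌋ ≡ true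
⌊⌋-yes a? a = trans (isYes≗does a?) (dec-true a? a)

⌊⌋-no : ∀ {A : Set} (a? : Dec A) → ¬ A → ⌊ a? ⌋ ≡ false
⌊⌋-no a? ¬a = cong ⌊_⌋ (dec-no a? ¬a)

⌊≟⌋-injective : ∀ {k p} {f : Fin k → Fin p} → Injective _≡_ _≡_ f →
                ∀ a b → ⌊ f a ≟ f b ⌋ ≡ (toℕ a ≡ᵇ toℕ b)
⌊≟⌋-injective {f = f} f-injective a b = trans (isYes≗does (f a ≟ f b))
  (does-⇔ (mk⇔ (cong toℕ ∘ f-injective) (cong f ∘ toℕ-injective)) (f a ≟ f b) (toℕ a ℕ.≟ toℕ b))

Joins : (G : Graph) → Fin (n G) → Fin (n G) → Fin (m G) → Set
Joins G u w e = (proj₁ (ends G e) ≡ u × proj₂ (ends G e) ≡ w)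
              ⊎ (proj₁ (ends G e) ≡ w × proj₂ (ends G e) ≡ u)

isEnd-joins : ∀ {G u w e} v → Joins G u w e → isEnd G v e ≡ ⌊ v ≟ u ⌋ ∨ ⌊ v ≟ w ⌋
isEnd-joins v (inj₁ (refl , refl)) = refl
isEnd-joins {G} {u} {w} v (inj₂ (refl , refl)) = ∨-comm ⌊ v ≟ w ⌋ ⌊ v ≟ u ⌋

data InInduced (G : Graph) (S : Pred (Fin (n G)) 0ℓ) : Pred (Elt G) 0ℓ where
  vertex : ∀ {v} → S v → InInduced G S (inj₁ v)
  edge   : ∀ {e} → S (proj₁ (ends G e)) → S (proj₂ (ends G e)) → InInduced G S (inj₂ e)

InInduced-mono : ∀ {G S T} → S ⊆ T → InInduced G S ⊆ InInduced G T
InInduced-mono S⊆T (vertex Sv)  = vertex (S⊆T Sv)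
InInduced-mono S⊆T (edge Su Sw) = edge (S⊆T Su) (S⊆T Sw)

joins-inInduced : ∀ {G S u w e} → Joins G u w e → S u → S w → InInduced G S (inj₂ e)
joins-inInduced (inj₁ (refl , refl)) Su Sw = edge Su Sw
joins-inInduced (inj₂ (refl , refl)) Su Sw = edge Sw Su

M-diagonal : ∀ G x → M G x x ≡ + 1
M-diagonal G (inj₁ v) = cong b2z (⌊⌋-yes (v ≟ v) refl)
M-diagonal G (inj₂ e) = cong b2z (⌊⌋-yes (e ≟ e) refl)

M≡0⇒≢ : ∀ {G x y} → M G x y ≡ + 0 → x ≢ y
M≡0⇒≢ {G} {x} M≡0 refl with () ← trans (sym M≡0) (M-diagonal G x)

⊥⇒≢ : ∀ {A : Set} {S T : Pred A 0ℓ} → S ⊥ T → ∀ {u w} → S u → T w → u ≢ w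
⊥⇒≢ S⊥T Su Tw refl = S⊥T (Su , Tw)

M-disjoint : ∀ {G S T} → S ⊥ T → ∀ {x y} → InInduced G S x → InInduced G T y → M G x y ≡ + 0
M-disjoint S⊥T (vertex {v} Sv) (vertex {w} Tw) = cong b2z (⌊⌋-no (v ≟ w) (⊥⇒≢ S⊥T Sv Tw))
M-disjoint S⊥T (vertex {v} Sv) (edge Tw₁ Tw₂) =
  cong b2z (cong₂ _∨_ (⌊⌋-no (v ≟ _) (⊥⇒≢ S⊥T Sv Tw₁)) (⌊⌋-no (v ≟ _) (⊥⇒≢ S⊥T Sv Tw₂)))
M-disjoint S⊥T (edge Su₁ Su₂) (vertex {w} Tw) =
  cong b2z (cong₂ _∨_ (⌊⌋-no (w ≟ _) (≢-sym (⊥⇒≢ S⊥T Su₁ Tw)))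
                      (⌊⌋-no (w ≟ _) (≢-sym (⊥⇒≢ S⊥T Su₂ Tw))))
M-disjoint S⊥T (edge {e} Su₁ _) (edge {f} Tw₁ _) =
  cong b2z (⌊⌋-no (e ≟ f) λ { refl → S⊥T (Su₁ , Tw₁) })

record SquareSubmatrix (G : Graph) (S : Pred (Fin (n G)) 0ℓ) (d : ℕ) : Set where
  field
    size           : ℕ
    rows cols      : Fin size → Elt G
    rows-injective : Injective _≡_ _≡_ rows
    cols-injective : Injective _≡_ _≡_ cols
    rows-induced   : ∀ i → InInduced G S (rows i)
    cols-induced   : ∀ i → InInduced G S (cols i)
    ∣det∣≡         : ∣ det size (λ i j → M G (rows i) (cols j)) ∣ ≡ d

SquareSubmatrix⇒Δ≥ : ∀ {G S d} → SquareSubmatrix G S d → Δ≥ G d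
SquareSubmatrix⇒Δ≥ A = size , rows , cols , rows-injective , cols-injective , ℕ.≤-reflexive (sym ∣det∣≡)
  where open SquareSubmatrix A

SquareSubmatrix-empty : ∀ {G S} → SquareSubmatrix G S 1
SquareSubmatrix-empty = record
  { size = 0 ; rows = λ () ; cols = λ ()
  ; rows-injective = λ {i} → case0 i ; cols-injective = λ {i} → case0 i
  ; rows-induced = λ () ; cols-induced = λ () ; ∣det∣≡ = refl }
  where
  case0 : ∀ {A : Set} → Fin 0 → A
  case0 ()

SquareSubmatrix-mono : ∀ {G S T d} → S ⊆ T → SquareSubmatrix G S d → SquareSubmatrix G T d
SquareSubmatrix-mono S⊆T A = record
  { size = size ; rows = rows ; cols = cols
  ; rows-injective = rows-injective ; cols-injective = cols-injective
  ; rows-induced = InInduced-mono S⊆T ∘ rows-induced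
  ; cols-induced = InInduced-mono S⊆T ∘ cols-induced
  ; ∣det∣≡ = ∣det∣≡ }
  where open SquareSubmatrix A

splitAt-injective : ∀ a {b} → Injective _≡_ _≡_ (splitAt a {b})
splitAt-injective a {b} {x} {y} eq = begin
  x                      ≡⟨ join-splitAt a b x ⟨
  join a b (splitAt a x) ≡⟨ cong (join a b) eq ⟩
  join a b (splitAt a y) ≡⟨ join-splitAt a b y ⟩
  y                      ∎

++-injective : ∀ {A : Set} {a b} {xs : Vector A a} {ys : Vector A b} →
               Injective _≡_ _≡_ xs → Injective _≡_ _≡_ ys → (∀ i j → xs i ≢ ys j) →
               Injective _≡_ _≡_ (xs ++ ys)
++-injective {a = a} {xs = xs} {ys} xs-injective ys-injective xs≢ys {x} {y} =
  splitAt-injective a ∘ injective (splitAt a x) (splitAt a y)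
  where
  injective : ∀ u w → [ xs , ys ]′ u ≡ [ xs , ys ]′ w → u ≡ w
  injective (inj₁ i) (inj₁ j) eq = cong inj₁ (xs-injective eq)
  injective (inj₁ i) (inj₂ j) eq = ⊥-elim (xs≢ys i j eq)
  injective (inj₂ i) (inj₁ j) eq = ⊥-elim (xs≢ys j i (sym eq))
  injective (inj₂ i) (inj₂ j) eq = cong inj₂ (ys-injective eq)

++-all : ∀ {A : Set} {P : Pred A 0ℓ} {a b} (xs : Vector A a) (ys : Vector A b) →
         (∀ i → P (xs i)) → (∀ j → P (ys j)) → ∀ x → P ((xs ++ ys) x)
++-all {a = a} xs ys Pxs Pys x with splitAt a x
... | inj₁ i = Pxs i
... | inj₂ j = Pys j

SquareSubmatrix-disjoint-∪ : ∀ {G S T a b} → S ⊥ T → SquareSubmatrix G S a → SquareSubmatrix G T b →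
                             SquareSubmatrix G (S ∪ T) (a ℕ.* b)
SquareSubmatrix-disjoint-∪ {G} {S} {T} {a} {b} S⊥T A B = record
  { size = size A ℕ.+ size B
  ; rows = rows A ++ rows B
  ; cols = cols A ++ cols B
  ; rows-injective = ++-injective (rows-injective A) (rows-injective B)
      (λ i j → M≡0⇒≢ (M-disjoint S⊥T (rows-induced A i) (rows-induced B j)))
  ; cols-injective = ++-injective (cols-injective A) (cols-injective B)
      (λ i j → M≡0⇒≢ (M-disjoint S⊥T (cols-induced A i) (cols-induced B j)))
  ; rows-induced = ++-all {P = InInduced G (S ∪ T)} (rows A) (rows B)
                     (left ∘ rows-induced A) (right ∘ rows-induced B)
  ; cols-induced = ++-all {P = InInduced G (S ∪ T)} (cols A) (cols B)
                     (left ∘ cols-induced A) (right ∘ cols-induced B)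
  ; ∣det∣≡ = begin
      ∣ det (size A ℕ.+ size B) AB ∣
        ≡⟨ cong ∣_∣ (det-blockLowerTriangular (size A) (size B) AB upperRight≡0) ⟩
      ∣ det (size A) _ * det (size B) _ ∣
        ≡⟨ cong ∣_∣ (cong₂ _*_ (det-cong (size A) blockA) (det-cong (size B) blockB)) ⟩
      ∣ detA * detB ∣
        ≡⟨ ℤ.abs-* detA detB ⟩
      ∣ detA ∣ ℕ.* ∣ detB ∣
        ≡⟨ cong₂ ℕ._*_ (∣det∣≡ A) (∣det∣≡ B) ⟩
      a ℕ.* b ∎
  }
  where
  open SquareSubmatrix
  left : InInduced G S ⊆ InInduced G (S ∪ T)
  left = InInduced-mono inj₁
  right : InInduced G T ⊆ InInduced G (S ∪ T)
  right = InInduced-mono inj₂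
  AB : Matrix (size A ℕ.+ size B)
  AB i j = M G ((rows A ++ rows B) i) ((cols A ++ cols B) j)
  detA detB : ℤ
  detA = det (size A) (λ i j → M G (rows A i) (cols A j))
  detB = det (size B) (λ i j → M G (rows B i) (cols B j))
  upperRight≡0 : ∀ r c → AB (r ↑ˡ size B) (size A ↑ʳ c) ≡ + 0
  upperRight≡0 r c rewrite lookup-++ˡ (rows A) (rows B) r | lookup-++ʳ (cols A) (cols B) c =
    M-disjoint S⊥T (rows-induced A r) (cols-induced B c)
  blockA : ∀ r c → AB (r ↑ˡ size B) (c ↑ˡ size B) ≡ M G (rows A r) (cols A c)
  blockA r c = cong₂ (M G) (lookup-++ˡ (rows A) (rows B) r) (lookup-++ˡ (cols A) (cols B) c)
  blockB : ∀ r c → AB (size A ↑ʳ r) (size A ↑ʳ c) ≡ M G (rows B r) (cols B c)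
  blockB r c = cong₂ (M G) (lookup-++ʳ (rows A) (rows B) r) (lookup-++ʳ (cols A) (cols B) c)

-- Cycles

OnCycle : ∀ {G} → Cycle G → Pred (Fin (n G)) 0ℓ
OnCycle C v = ∃ λ a → vert C a ≡ v

module CycleSubmatrix (G : Graph) (ℓ : ℕ)
  (vert : Fin (3 ℕ.+ ℓ) → Fin (n G)) (vert-injective : Injective _≡_ _≡_ vert)
  (step : ∀ i → Adj G (vert (inject₁ i)) (vert (suc i)))
  (close : Adj G (vert (fromℕ (2 ℕ.+ ℓ))) (vert zero)) where

  onCycle : Pred (Fin (n G)) 0ℓ
  onCycle v = ∃ λ a → vert a ≡ v

  next : Fin (3 ℕ.+ ℓ) → Fin (3 ℕ.+ ℓ)
  next i = cyclicSuc (view i)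

  edgeAt : ∀ {i} (w : View i) → ∃ (Joins G (vert i) (vert (cyclicSuc w)))
  edgeAt ‵fromℕ       = close
  edgeAt (‵inject₁ j) = step j

  cycleEdge : Fin (3 ℕ.+ ℓ) → Fin (m G)
  cycleEdge i = proj₁ (edgeAt (view i))

  cycleEdge-joins : ∀ i → Joins G (vert i) (vert (next i)) (cycleEdge i)
  cycleEdge-joins i = proj₂ (edgeAt (view i))

  isEnd-vert-cycleEdge : ∀ i j →
    isEnd G (vert i) (cycleEdge j) ≡ cycleIncidence (3 ℕ.+ ℓ) (toℕ i) (toℕ j)
  isEnd-vert-cycleEdge i j = begin
    isEnd G (vert i) (cycleEdge j)
      ≡⟨ isEnd-joins {G} (vert i) (cycleEdge-joins j) ⟩
    ⌊ vert i ≟ vert j ⌋ ∨ ⌊ vert i ≟ vert (next j) ⌋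
      ≡⟨ cong₂ _∨_ (⌊≟⌋-injective vert-injective i j) (⌊≟⌋-injective vert-injective i (next j)) ⟩
    (toℕ i ≡ᵇ toℕ j) ∨ (toℕ i ≡ᵇ toℕ (next j))
      ≡⟨ cycleIncidence-cyclicSuc (view j) (s≤s⁻¹ (toℕ<n i)) ⟩
    cycleIncidence (3 ℕ.+ ℓ) (toℕ i) (toℕ j) ∎

  -- vert i lies on cycleEdge i, so cycleEdge i ≡ cycleEdge j makes i and j incident both ways,
  -- which on a cycle of length at least 3 forces i ≡ j.
  cycleEdge-injective : Injective _≡_ _≡_ cycleEdge
  cycleEdge-injective eq = toℕ-injective (cycleIncidence-antisym ℓ (incident eq) (incident (sym eq)))
    where
    incident : ∀ {i j} → cycleEdge i ≡ cycleEdge j → CycleIncident (3 ℕ.+ ℓ) (toℕ i) (toℕ j)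
    incident {i} {j} eq = cycleIncidence-sound _ _ _ (begin
      cycleIncidence (3 ℕ.+ ℓ) (toℕ i) (toℕ j)  ≡⟨ isEnd-vert-cycleEdge i j ⟨
      isEnd G (vert i) (cycleEdge j)            ≡⟨ cong (isEnd G (vert i)) eq ⟨
      isEnd G (vert i) (cycleEdge i)            ≡⟨ isEnd-vert-cycleEdge i i ⟩
      cycleIncidence (3 ℕ.+ ℓ) (toℕ i) (toℕ i)  ≡⟨ cycleIncidence-complete (3 ℕ.+ ℓ) (toℕ i) _ (inj₁ refl) ⟩
      true                                      ∎)

  vert-induced : ∀ i → InInduced G onCycle (inj₁ (vert i))
  vert-induced i = vertex (i , refl)

  cycleEdge-induced : ∀ i → InInduced G onCycle (inj₂ (cycleEdge i))
  cycleEdge-induced i = joins-inInduced (cycleEdge-joins i) (i , refl) (next i , refl)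

  vertexEdgeSubmatrix : sign (2 ℕ.+ ℓ) ≡ + 1 → SquareSubmatrix G onCycle 2
  vertexEdgeSubmatrix sign≡1 = record
    { size = 3 ℕ.+ ℓ
    ; rows = inj₁ ∘ vert
    ; cols = inj₂ ∘ cycleEdge
    ; rows-injective = vert-injective ∘ inj₁-injective
    ; cols-injective = cycleEdge-injective ∘ inj₂-injective
    ; rows-induced = vert-induced
    ; cols-induced = cycleEdge-induced
    ; ∣det∣≡ = cong ∣_∣ (begin
        det (3 ℕ.+ ℓ) (λ i j → b2z (isEnd G (vert i) (cycleEdge j)))
          ≡⟨ det-cong (3 ℕ.+ ℓ) (λ i j → cong b2z (isEnd-vert-cycleEdge i j)) ⟩
        det (3 ℕ.+ ℓ) (cycleMatrix (3 ℕ.+ ℓ))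
          ≡⟨ det-cycleMatrix (suc ℓ) ⟩
        + 1 + sign (2 ℕ.+ ℓ)
          ≡⟨ cong (_+_ (+ 1)) sign≡1 ⟩
        + 2 ∎)
    }

  -- Rows vert 0, edge 0, vert 1, …, vert (2 + ℓ) and columns vert 0, vert 1, edge 1, …, edge (2 + ℓ):
  -- the incidence pattern of a cycle one longer than this one.
  extendedRows : Fin (4 ℕ.+ ℓ) → Elt G
  extendedRows zero          = inj₁ (vert zero)
  extendedRows (suc zero)    = inj₂ (cycleEdge zero)
  extendedRows (suc (suc i)) = inj₁ (vert (suc i))

  extendedCols : Fin (4 ℕ.+ ℓ) → Elt G
  extendedCols zero          = inj₁ (vert zero)
  extendedCols (suc zero)    = inj₁ (vert (suc zero))
  extendedCols (suc (suc j)) = inj₂ (cycleEdge (suc j))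

  extendedRows-injective : Injective _≡_ _≡_ extendedRows
  extendedRows-injective {zero}        {zero}        _  = refl
  extendedRows-injective {zero}        {suc (suc j)} eq with () ← vert-injective (inj₁-injective eq)
  extendedRows-injective {suc zero}    {suc zero}    _  = refl
  extendedRows-injective {suc (suc i)} {zero}        eq with () ← vert-injective (inj₁-injective eq)
  extendedRows-injective {suc (suc i)} {suc (suc j)} eq = cong suc (vert-injective (inj₁-injective eq))

  extendedCols-injective : Injective _≡_ _≡_ extendedCols
  extendedCols-injective {zero}        {zero}        _  = refl
  extendedCols-injective {zero}        {suc zero}    eq with () ← vert-injective (inj₁-injective eq)
  extendedCols-injective {suc zero}    {zero}        eq with () ← vert-injective (inj₁-injective eq)
  extendedCols-injective {suc zero}    {suc zero}    _  = refl
  extendedCols-injective {suc (suc i)} {suc (suc j)} eq = cong suc (cycleEdge-injective (inj₂-injective eq))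

  extendedRows-induced : ∀ i → InInduced G onCycle (extendedRows i)
  extendedRows-induced zero          = vert-induced zero
  extendedRows-induced (suc zero)    = cycleEdge-induced zero
  extendedRows-induced (suc (suc i)) = vert-induced (suc i)

  extendedCols-induced : ∀ i → InInduced G onCycle (extendedCols i)
  extendedCols-induced zero          = vert-induced zero
  extendedCols-induced (suc zero)    = vert-induced (suc zero)
  extendedCols-induced (suc (suc i)) = cycleEdge-induced (suc i)

  extended≡cycleMatrix : ∀ x y → M G (extendedRows x) (extendedCols y) ≡ cycleMatrix (4 ℕ.+ ℓ) x y
  extended≡cycleMatrix zero          zero          = M-diagonal G (inj₁ (vert zero))
  extended≡cycleMatrix zero          (suc zero)    = cong b2z (⌊≟⌋-injective vert-injective zero (suc zero))
  extended≡cycleMatrix zero          (suc (suc j)) = cong b2z (isEnd-vert-cycleEdge zero (suc j))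
  extended≡cycleMatrix (suc zero)    zero          = cong b2z (isEnd-vert-cycleEdge zero zero)
  extended≡cycleMatrix (suc zero)    (suc zero)    = cong b2z (isEnd-vert-cycleEdge (suc zero) zero)
  extended≡cycleMatrix (suc zero)    (suc (suc j)) = cong b2z (⌊≟⌋-injective cycleEdge-injective zero (suc j))
  extended≡cycleMatrix (suc (suc i)) zero          = cong b2z (⌊≟⌋-injective vert-injective (suc i) zero)
  extended≡cycleMatrix (suc (suc i)) (suc zero)    =
    cong b2z (trans (⌊≟⌋-injective vert-injective (suc i) (suc zero)) (sym (∨-identityʳ _)))
  extended≡cycleMatrix (suc (suc i)) (suc (suc j)) = cong b2z (isEnd-vert-cycleEdge (suc i) (suc j))

  extendedSubmatrix : sign (3 ℕ.+ ℓ) ≡ + 1 → SquareSubmatrix G onCycle 2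
  extendedSubmatrix sign≡1 = record
    { size = 4 ℕ.+ ℓ
    ; rows = extendedRows
    ; cols = extendedCols
    ; rows-injective = extendedRows-injective
    ; cols-injective = extendedCols-injective
    ; rows-induced = extendedRows-induced
    ; cols-induced = extendedCols-induced
    ; ∣det∣≡ = cong ∣_∣ (begin
        det (4 ℕ.+ ℓ) (λ i j → M G (extendedRows i) (extendedCols j))
          ≡⟨ det-cong (4 ℕ.+ ℓ) extended≡cycleMatrix ⟩
        det (4 ℕ.+ ℓ) (cycleMatrix (4 ℕ.+ ℓ))
          ≡⟨ det-cycleMatrix (2 ℕ.+ ℓ) ⟩
        + 1 + sign (3 ℕ.+ ℓ)
          ≡⟨ cong (_+_ (+ 1)) sign≡1 ⟩
        + 2 ∎)
    }

  submatrix : SquareSubmatrix G onCycle 2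
  submatrix with sign-parity (2 ℕ.+ ℓ)
  ... | inj₁ oddLength  = vertexEdgeSubmatrix oddLength
  ... | inj₂ evenLength = extendedSubmatrix evenLength

cycle-submatrix : ∀ {G} (C : Cycle G) → SquareSubmatrix G (OnCycle C) 2
cycle-submatrix {G} record
  { len≥3 = s≤s (s≤s {n = ℓ} z≤n) ; vert = vert ; distinct = distinct ; step = step ; close = close } =
  CycleSubmatrix.submatrix G ℓ vert distinct step close

disjointCycles-submatrix : ∀ {G} k (C : Fin k → Cycle G) →
  (∀ i j → i ≢ j → ∀ a b → vert (C i) a ≢ vert (C j) b) →
  SquareSubmatrix G (⋃ (Fin k) (OnCycle ∘ C)) (2 ^ k)
disjointCycles-submatrix zero    C disjoint = SquareSubmatrix-empty
disjointCycles-submatrix (suc k) C disjoint =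
  SquareSubmatrix-mono ∪⊆⋃ (SquareSubmatrix-disjoint-∪ first⊥rest
    (cycle-submatrix (C zero))
    (disjointCycles-submatrix k (C ∘ suc) λ i j i≢j → disjoint (suc i) (suc j) (i≢j ∘ suc-injective)))
  where
  first⊥rest : OnCycle (C zero) ⊥ ⋃ (Fin k) (OnCycle ∘ C ∘ suc)
  first⊥rest ((a , refl) , (j , b , eq)) = disjoint zero (suc j) (λ ()) a b (sym eq)
  ∪⊆⋃ : OnCycle (C zero) ∪ ⋃ (Fin k) (OnCycle ∘ C ∘ suc) ⊆ ⋃ (Fin (suc k)) (OnCycle ∘ C)
  ∪⊆⋃ (inj₁ onFirst)       = zero , onFirst
  ∪⊆⋃ (inj₂ (j , onRest)) = suc j , onRest

lemma3 : (k : ℕ) (G : Graph) → DisjointCycles G k → Δ≥ G (2 ^ k)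
lemma3 k G (C , disjoint) = SquareSubmatrix⇒Δ≥ (disjointCycles-submatrix k C disjoint)
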